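{- Let $m\in\{2,3,4\}$ and let $H$ be a $3$-uniform hypergraph with clique number $k\ge 3$. Let $N_1,\dots,N_\ell$ ($\ell\ge 3$) be $k$-cliques of $H$ with $\bigcap_{i=1}^{\ell}N_i=\varnothing$ and $\bigcap_{j\ne i}N_j\ne\varnothing$ for every $i$, and let $V=\bigcup_{i=1}^\ell N_i$, with $|V|=n$ and $m=n-k$. Suppose $p_1,\dots,p_\ell\subset V$ are $2$-element sets such that $p_i\subseteq N_j$ if and only if $i=j$, and let $G$ be the graph on $V$ with edge set $\{p_1,\dots,p_\ell\}$. For a graph $F$ on $V$ whose edge set is $\{p_i: i\in I\}$ for an index set $I$, and for $j\in I$, let $F\setminus p_j$ denote the graph on $V\setminus p_j$ whose edges/loops are the sets $p_h\setminus p_j$, $h\in I\setminus\{j\}$; define $w_F(p_j)=m-\tau(F\setminus p_j)$, $w(F)=\sum_{j\in I}w_F(p_j)$ and $V_0(F)=\bigcup_{i\in I}p_i$. If $w_G(p_\ell)=0$, then the graph $G'=G-p_\ell$ (with edge set $\{p_1,\dots,p_{\ell-1}\}$) satisfies $$|V_0(G)|+w(G)\le |V_0(G')|+w(G').$$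
   Context: A clique of a $3$-uniform hypergraph is a vertex set all of whose $3$-subsets are edges. For a graph possibly containing loops (a loop being a $1$-element set $\{v\}$), $\tau$ denotes the transversal number: the minimum size of a vertex set meeting every edge and every loop. $G-p_\ell$ denotes the graph obtained from $G$ by deleting the edge $p_\ell$ only (keeping all vertices). -}

module Defs where

open import Data.Nat using (ℕ; zero; suc; _⊓_)
open import Data.Bool using (Bool; _∧_)
open import Data.Fin using (Fin)
open import Data.Fin.Subset using (Subset; inside; outside; _∩_; _─_; _⊆_; _∈_; ∣_∣; ⋃)
open import Data.Fin.Subset.Properties using (_⊆?_; _∈?_; nonempty?)
open import Data.List using (List; []; _∷_; map; _++_; foldr; filter; filterᵇ; allFin)
open import Data.Bool.ListAction using (all)
open import Data.Fin using (_≟_)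
open import Relation.Nullary.Decidable using (¬?)
open import Data.Vec using (_∷_; [])
open import Data.Integer as ℤ using (ℤ; +_)
open import Relation.Nullary using (does; ¬_)
open import Relation.Binary.PropositionalEquality using (_≡_)
open import Data.Product using (∃; _×_)

record Hypergraph3 (N : ℕ) : Set₁ where
  field
    Edge    : Subset N → Set
    uniform : ∀ e → Edge e → ∣ e ∣ ≡ 3

IsClique : ∀ {N} → Hypergraph3 N → Subset N → Set
IsClique H S = ∀ T → T ⊆ S → ∣ T ∣ ≡ 3 → Hypergraph3.Edge H T

CliqueNumber : ∀ {N} → Hypergraph3 N → ℕ → Set
CliqueNumber H k =
  (∃ λ S → IsClique H S × ∣ S ∣ ≡ k) × (∀ S → IsClique H S → ∣ S ∣ Data.Nat.≤ k)

-- Graphs with loops on a vertex set W ⊆ Fin N, given by a list of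
-- edges/loops (subsets of W of size 1 or 2).

allSubsets : (N : ℕ) → List (Subset N)
allSubsets zero    = [] ∷ []
allSubsets (suc N) = map (outside ∷_) (allSubsets N) ++ map (inside ∷_) (allSubsets N)

isTransversal : ∀ {N} → Subset N → List (Subset N) → Subset N → Bool
isTransversal W E T = does (T ⊆? W) ∧ all (λ e → does (nonempty? (T ∩ e))) E

-- transversal number τ: minimum size of a transversal
-- (N is only a starting upper bound for the minimum; W itself is a
--  transversal whenever every edge is a nonempty subset of W)
τ : ∀ {N} → Subset N → List (Subset N) → ℕ
τ {N} W E = foldr _⊓_ N (map ∣_∣ (filterᵇ (isTransversal W E) (allSubsets N)))

-- Graphs F on V given by an index set I ⊆ Fin ℓ, with edges p i, i ∈ I.

module _ {N ℓ : ℕ} (V : Subset N) (p : Fin ℓ → Subset N) where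

  idx : Subset ℓ → List (Fin ℓ)
  idx I = filter (_∈? I) (allFin ℓ)

  delVertices : Fin ℓ → Subset N
  delVertices j = V ─ p j

  delEdges : Subset ℓ → Fin ℓ → List (Subset N)
  delEdges I j = map (λ h → p h ─ p j) (filter (λ h → ¬? (h ≟ j)) (idx I))

  wt : ℕ → Subset ℓ → Fin ℓ → ℤ
  wt m I j = (+ m) ℤ.- (+ τ (delVertices j) (delEdges I j))

  W : ℕ → Subset ℓ → ℤ
  W m I = foldr ℤ._+_ (+ 0) (map (wt m I) (idx I))

  V₀ : Subset ℓ → Subset N
  V₀ I = ⋃ (map p (idx I))

-- Deleting p_ℓ shrinks V₀ only by the vertices of p_ℓ outside A = V₀(G′), at most two
-- of them, and w(G) loses the term w_G(p_ℓ) = 0. Every other weight can only grow, since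
-- τ is monotone in the edge list; w(p_j) grows by at least one as soon as p_ℓ ∖ p_j is
-- an edge of G ∖ p_j disjoint from all the others, as happens when p_ℓ ∩ A ⊆ p_j. If p_ℓ misses
-- A this holds for every j (and ℓ ≥ 3 gives two of them); if p_ℓ meets A in a vertex y
-- and has a vertex outside A, then p_ℓ ∩ A = {y} and it holds for a pair p_j ∋ y.

module Submission where

open import Defs
open import Data.Nat as ℕ using (ℕ; suc; _+_; _∸_; _≤_; _<_; _⊓_; z≤n; s≤s)
import Data.Nat.Properties as ℕₚ
open import Data.Nat.ListAction using (sum)
open import Data.Integer as ℤ using (ℤ; +_; +≤+)
import Data.Integer.Properties as ℤₚ
open import Data.Integer.Solver using (module +-*-Solver)
open import Algebra.Properties.CommutativeSemigroup ℤₚ.+-commutativeSemigroup using (interchange; xy∙z≈x∙zy)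
open import Data.Bool using (T)
open import Data.Bool.Properties using (T-∧)
open import Data.Fin using (Fin; zero; suc; fromℕ; _≟_)
open import Data.Fin.Subset
  using (Subset; inside; outside; ⊤; ⊥; ⁅_⁆; _∩_; _∪_; _─_; _-_; _⊆_; _∈_; _∉_; ∣_∣; ⋃; Nonempty; Empty)
open import Data.Fin.Subset.Properties
  using ( _⊆?_; _∈?_; nonempty?; ∈⊤; ∉⊥; ∣p∣≤n; ∣p∣≤∣x∷p∣; ∣⊥∣≡0; Empty-unique
        ; p⊆q⇒∣p∣≤∣q∣; p─q⊆p; ∣p─q∣≤∣p∣; p∩q≢∅⇒∣p─q∣<∣p∣; x∈p⇒∣p-x∣<∣p∣
        ; x∈p∩q⁺; x∈p∩q⁻; x∈p∪q⁺; x∈p∪q⁻; x∈p∧x∉q⇒x∈p─q; x∈p∧x≢y⇒x∈p-y; x∈⁅x⁆; x∉⁅y⁆⇒x≢y)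
open import Data.List using (List; []; _∷_; map; foldr; filter; filterᵇ; allFin)
open import Data.List.Properties using (foldr-preservesᵇ; foldr-preservesᵒ; filter-accept; filter-reject)
open import Data.List.Membership.Propositional using (find; lose) renaming (_∈_ to _∈ᴸ_)
open import Data.List.Membership.Propositional.Properties
  using (∈-map⁺; ∈-map⁻; ∈-filter⁺; ∈-filter⁻; ∈-allFin; ∈-++⁺ˡ; ∈-++⁺ʳ)
open import Data.List.Relation.Unary.All as All using (All)
open import Data.List.Relation.Unary.All.Properties using (all⁺; all⁻)
open import Data.List.Relation.Unary.Any as Any using (Any; here; there)
open import Data.List.Relation.Unary.Any.Properties using (map⁺; map⁻)
open import Data.Vec using ([]; _∷_)
open import Data.Vec.Base using () renaming (here to hereᵛ; there to thereᵛ)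
open import Data.Product using (∃; _×_; _,_; proj₁; proj₂)
open import Data.Sum using (_⊎_; inj₁; inj₂; [_,_])
open import Data.Empty using (⊥-elim)
open import Function using (const)
open import Function.Bundles using (_⇔_; mk⇔; Equivalence)
open import Relation.Nullary using (Dec; yes; no; does; ¬_)
open import Relation.Nullary.Decidable using (decidable-stable; ¬?)
open import Relation.Binary.PropositionalEquality
  using (_≡_; _≢_; refl; sym; trans; cong; cong₂; subst; module ≡-Reasoning)

private
  variable
    n ℓ : ℕ

x∈p─q⇒x∉q : ∀ {x : Fin n} {p q : Subset n} → x ∈ p ─ q → x ∉ q
x∈p─q⇒x∉q {p = _ ∷ _} {outside ∷ _} hereᵛ        ()
x∈p─q⇒x∉q {p = _ ∷ _} {inside ∷ _}  ()            hereᵛ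
x∈p─q⇒x∉q {p = _ ∷ _} {_ ∷ _}       (thereᵛ x∈)   (thereᵛ x∈q) = x∈p─q⇒x∉q x∈ x∈q

x∈p─q⁻ : ∀ {x : Fin n} {p q : Subset n} → x ∈ p ─ q → x ∈ p × x ∉ q
x∈p─q⁻ {p = p} {q} x∈ = p─q⊆p p q x∈ , x∈p─q⇒x∉q x∈

p⊈q⇒Nonempty[p─q] : (p q : Subset n) → ¬ p ⊆ q → Nonempty (p ─ q)
p⊈q⇒Nonempty[p─q] p q p⊈q = decidable-stable (nonempty? (p ─ q)) λ empty →
  p⊈q λ {x} x∈p → decidable-stable (x ∈? q) λ x∉q →
    empty (x , x∈p∧x∉q⇒x∈p─q x∈p x∉q)

Empty⇒∣p∣≡0 : {p : Subset n} → Empty p → ∣ p ∣ ≡ 0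
Empty⇒∣p∣≡0 {n} empty = trans (cong ∣_∣ (Empty-unique empty)) (∣⊥∣≡0 n)

∣p∪q∣≤∣p∣+∣q∣ : (p q : Subset n) → ∣ p ∪ q ∣ ≤ ∣ p ∣ + ∣ q ∣
∣p∪q∣≤∣p∣+∣q∣ []            []            = z≤n
∣p∪q∣≤∣p∣+∣q∣ (outside ∷ p) (outside ∷ q) = ∣p∪q∣≤∣p∣+∣q∣ p q
∣p∪q∣≤∣p∣+∣q∣ (outside ∷ p) (inside ∷ q)  =
  ℕₚ.≤-trans (s≤s (∣p∪q∣≤∣p∣+∣q∣ p q)) (ℕₚ.≤-reflexive (sym (ℕₚ.+-suc ∣ p ∣ ∣ q ∣)))
∣p∪q∣≤∣p∣+∣q∣ (inside ∷ p)  (x ∷ q)       =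
  s≤s (ℕₚ.≤-trans (∣p∪q∣≤∣p∣+∣q∣ p q) (ℕₚ.+-monoʳ-≤ ∣ p ∣ (∣p∣≤∣x∷p∣ x q)))

3≤∣p∣ : ∀ {p : Subset n} {x y z} → x ∈ p → y ∈ p → z ∈ p →
        x ≢ y → x ≢ z → y ≢ z → 3 ≤ ∣ p ∣
3≤∣p∣ {p = p} {x} {y} {z} x∈p y∈p z∈p x≢y x≢z y≢z = begin-strict
  2                 ≤⟨ s≤s (ℕₚ.≤-trans (s≤s z≤n) (x∈p⇒∣p-x∣<∣p∣ z∈p-x-y)) ⟩
  suc ∣ p - x - y ∣ ≤⟨ x∈p⇒∣p-x∣<∣p∣ y∈p-x ⟩
  ∣ p - x ∣         <⟨ x∈p⇒∣p-x∣<∣p∣ x∈p ⟩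
  ∣ p ∣             ∎
  where
  open ℕₚ.≤-Reasoning
  y∈p-x = x∈p∧x≢y⇒x∈p-y y∈p (λ y≡x → x≢y (sym y≡x))
  z∈p-x-y = x∈p∧x≢y⇒x∈p-y (x∈p∧x≢y⇒x∈p-y z∈p (λ z≡x → x≢z (sym z≡x))) (λ z≡y → y≢z (sym z≡y))

∣p∣≤2⇒≡ : ∀ {p : Subset n} {x y z} → ∣ p ∣ ≤ 2 → x ∈ p → y ∈ p → z ∈ p →
          x ≢ y → x ≢ z → y ≡ z
∣p∣≤2⇒≡ {y = y} {z} ∣p∣≤2 x∈p y∈p z∈p x≢y x≢z = decidable-stable (y ≟ z) λ y≢z →
  ℕₚ.<⇒≱ (3≤∣p∣ x∈p y∈p z∈p x≢y x≢z y≢z) ∣p∣≤2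

x∈⋃⁺ : ∀ {x : Fin n} {ps} → Any (x ∈_) ps → x ∈ ⋃ ps
x∈⋃⁺ (here x∈p)   = x∈p∪q⁺ (inj₁ x∈p)
x∈⋃⁺ (there x∈ps) = x∈p∪q⁺ (inj₂ (x∈⋃⁺ x∈ps))

x∈⋃⁻ : ∀ {x : Fin n} ps → x ∈ ⋃ ps → Any (x ∈_) ps
x∈⋃⁻ []       x∈ = ⊥-elim (∉⊥ x∈)
x∈⋃⁻ (p ∷ ps) x∈ with x∈p∪q⁻ p (⋃ ps) x∈
... | inj₁ x∈p  = here x∈p
... | inj₂ x∈ps = there (x∈⋃⁻ ps x∈ps)

Transversal : Subset n → List (Subset n) → Subset n → Set
Transversal W E S = S ⊆ W × All (λ e → Nonempty (S ∩ e)) E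

T-does⇔ : ∀ {A : Set} (a? : Dec A) → T (does a?) ⇔ A
T-does⇔ (yes a) = mk⇔ (const a) (const _)
T-does⇔ (no ¬a) = mk⇔ (λ ()) ¬a

module _ {W : Subset n} {E : List (Subset n)} {S : Subset n} where

  isTransversal⇒Transversal : T (isTransversal W E S) → Transversal W E S
  isTransversal⇒Transversal t =
    Equivalence.to (T-does⇔ (S ⊆? W)) t₁ ,
    All.map (λ {e} → Equivalence.to (T-does⇔ (nonempty? (S ∩ e)))) (all⁺ _ E t₂)
    where
    t₁ = proj₁ (Equivalence.to T-∧ t)
    t₂ = proj₂ (Equivalence.to T-∧ t)

  Transversal⇒isTransversal : Transversal W E S → T (isTransversal W E S)
  Transversal⇒isTransversal (S⊆W , meets) = Equivalence.from T-∧
    ( Equivalence.from (T-does⇔ (S ⊆? W)) S⊆W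
    , all⁻ _ (All.map (λ {e} → Equivalence.from (T-does⇔ (nonempty? (S ∩ e)))) meets))

∈-allSubsets : (S : Subset n) → S ∈ᴸ allSubsets n
∈-allSubsets []            = here refl
∈-allSubsets (outside ∷ S) = ∈-++⁺ˡ (∈-map⁺ (outside ∷_) (∈-allSubsets S))
∈-allSubsets {suc n} (inside ∷ S) =
  ∈-++⁺ʳ (map (outside ∷_) (allSubsets n)) (∈-map⁺ (inside ∷_) (∈-allSubsets S))

m≤o⊎n≤o⇒m⊓n≤o : ∀ {o} m n → m ≤ o ⊎ n ≤ o → m ⊓ n ≤ o
m≤o⊎n≤o⇒m⊓n≤o m n = [ ℕₚ.m≤n⇒m⊓o≤n n , ℕₚ.m≤n⇒o⊓m≤n m ]

module _ {W : Subset n} {E : List (Subset n)} where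

  transversalSizes : List ℕ
  transversalSizes = map ∣_∣ (filterᵇ (isTransversal W E) (allSubsets n))

  τ≤∣S∣ : ∀ {S} → Transversal W E S → τ W E ≤ ∣ S ∣
  τ≤∣S∣ {S} tr = foldr-preservesᵒ m≤o⊎n≤o⇒m⊓n≤o n transversalSizes
                   (inj₂ (Any.map (λ ∣S∣≡y → ℕₚ.≤-reflexive (sym ∣S∣≡y)) ∣S∣∈sizes))
    where
    ∣S∣∈sizes : ∣ S ∣ ∈ᴸ transversalSizes
    ∣S∣∈sizes = ∈-map⁺ ∣_∣ (∈-filter⁺ _ (∈-allSubsets S) (Transversal⇒isTransversal tr))

  τ≤n : τ W E ≤ n
  τ≤n = foldr-preservesᵒ m≤o⊎n≤o⇒m⊓n≤o n transversalSizes (inj₁ ℕₚ.≤-refl)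

  τ-greatest : ∀ {b} → b ≤ n → (∀ S → Transversal W E S → b ≤ ∣ S ∣) → b ≤ τ W E
  τ-greatest {b} b≤n b≤tr = foldr-preservesᵇ ℕₚ.⊓-glb b≤n (All.tabulate b≤size)
    where
    b≤size : ∀ {y} → y ∈ᴸ transversalSizes → b ≤ y
    b≤size y∈ with ∈-map⁻ ∣_∣ y∈
    ... | S , S∈ , refl =
      b≤tr S (isTransversal⇒Transversal (proj₂ (∈-filter⁻ _ {xs = allSubsets n} S∈)))

module _ {W : Subset n} {E E′ : List (Subset n)} (E⊆E′ : ∀ {f} → f ∈ᴸ E → f ∈ᴸ E′) where

  τ-mono : τ W E ≤ τ W E′
  τ-mono = τ-greatest (τ≤n {E = E}) λ S (S⊆W , meets) →
    τ≤∣S∣ (S⊆W , All.tabulate λ f∈E → All.lookup meets (E⊆E′ f∈E))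

  -- A transversal of E′ minus the new edge e is still a transversal of E, and is smaller.
  τ-mono-strict : ∀ {e} → e ∈ᴸ E′ → (∀ {f} → f ∈ᴸ E → ∀ {v} → v ∈ f → v ∉ e) →
                  ∀ {S₀} → Transversal W E′ S₀ → τ W E < τ W E′
  τ-mono-strict {e} e∈E′ disjoint {S₀} tr₀ =
    τ-greatest (ℕₚ.≤-trans (τ<∣S∣ S₀ tr₀) (∣p∣≤n S₀)) τ<∣S∣
    where
    τ<∣S∣ : ∀ S → Transversal W E′ S → τ W E < ∣ S ∣
    τ<∣S∣ S (S⊆W , meets) = ℕₚ.≤-<-trans (τ≤∣S∣ (S─e⊆W , S─e-meets))
                                       (p∩q≢∅⇒∣p─q∣<∣p∣ S e (All.lookup meets e∈E′))
      where
      S─e⊆W : S ─ e ⊆ W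
      S─e⊆W v∈ = S⊆W (p─q⊆p S e v∈)
      S─e-meets : All (λ f → Nonempty ((S ─ e) ∩ f)) E
      S─e-meets = All.tabulate λ f∈E →
        let v , v∈S∩f = All.lookup meets (E⊆E′ f∈E)
            v∈S , v∈f = x∈p∩q⁻ S _ v∈S∩f
        in v , x∈p∩q⁺ (x∈p∧x∉q⇒x∈p─q v∈S (disjoint f∈E v∈f) , v∈f)

m-n+[n∸o]≡m-o : ∀ m {n o} → o ≤ n → (+ m ℤ.- + n) ℤ.+ + (n ∸ o) ≡ + m ℤ.- + o
m-n+[n∸o]≡m-o m {n} {o} o≤n = begin
  (+ m ℤ.- + n) ℤ.+ + d             ≡⟨ cong (λ k → (+ m ℤ.- k) ℤ.+ + d) +n≡+d++o ⟩
  (+ m ℤ.- (+ d ℤ.+ + o)) ℤ.+ + d   ≡⟨ solve 3 (λ m d o → (m :- (d :+ o)) :+ d := m :- o) refl (+ m) (+ d) (+ o) ⟩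
  + m ℤ.- + o                       ∎
  where
  open ≡-Reasoning
  open +-*-Solver
  d = n ∸ o
  +n≡+d++o : + n ≡ + d ℤ.+ + o
  +n≡+d++o = trans (cong +_ (sym (ℕₚ.m∸n+n≡m o≤n))) (ℤₚ.pos-+ d o)

Σ : {A : Set} → (A → ℤ) → List A → ℤ
Σ f zs = foldr ℤ._+_ (+ 0) (map f zs)

Σ-+-sum : ∀ {A : Set} {f g : A → ℤ} {d : A → ℕ} → (∀ z → f z ℤ.+ + d z ≡ g z) →
          ∀ zs → Σ f zs ℤ.+ + sum (map d zs) ≡ Σ g zs
Σ-+-sum f+d≡g []       = refl
Σ-+-sum {f = f} {g} {d} f+d≡g (z ∷ zs) = begin
  (f z ℤ.+ Σ f zs) ℤ.+ + (d z + D)      ≡⟨ cong (ℤ._+_ (f z ℤ.+ Σ f zs)) (ℤₚ.pos-+ (d z) D) ⟩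
  (f z ℤ.+ Σ f zs) ℤ.+ (+ d z ℤ.+ + D)  ≡⟨ interchange (f z) (Σ f zs) (+ d z) (+ D) ⟩
  (f z ℤ.+ + d z) ℤ.+ (Σ f zs ℤ.+ + D)  ≡⟨ cong₂ ℤ._+_ (f+d≡g z) (Σ-+-sum f+d≡g zs) ⟩
  g z ℤ.+ Σ g zs                        ∎
  where
  open ≡-Reasoning
  D = sum (map d zs)

Σ-filter-─ : ∀ {f : Fin ℓ → ℤ} {i} (I : Subset ℓ) → f i ≡ + 0 → ∀ zs →
             Σ f (filter (_∈? I) zs) ≡ Σ f (filter (_∈? I - i) zs)
Σ-filter-─ I fi≡0 [] = refl
Σ-filter-─ {f = f} {i} I fi≡0 (z ∷ zs) with z ∈? I | z ≟ i
... | no z∉I  | _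
  rewrite filter-reject (_∈? I - i) {xs = zs} (λ z∈ → z∉I (p─q⊆p I ⁅ i ⁆ z∈))
  = Σ-filter-─ I fi≡0 zs
... | yes _   | yes refl
  rewrite filter-reject (_∈? I - i) {xs = zs} (λ z∈ → x∈p─q⇒x∉q z∈ (x∈⁅x⁆ i)) | fi≡0
  = trans (ℤₚ.+-identityˡ _) (Σ-filter-─ I fi≡0 zs)
... | yes z∈I | no z≢i
  rewrite filter-accept (_∈? I - i) {xs = zs} (x∈p∧x≢y⇒x∈p-y z∈I z≢i)
  = cong (ℤ._+_ (f z)) (Σ-filter-─ I fi≡0 zs)

f≤sum-map : ∀ {A : Set} (f : A → ℕ) {z zs} → z ∈ᴸ zs → f z ≤ sum (map f zs)
f≤sum-map f (here refl)                  = ℕₚ.m≤m+n _ _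
f≤sum-map f {zs = z ∷ _} (there z′∈zs) = ℕₚ.≤-trans (f≤sum-map f z′∈zs) (ℕₚ.m≤n+m _ (f z))

f+f≤sum-map : ∀ {A : Set} (f : A → ℕ) {a b zs} → a ∈ᴸ zs → b ∈ᴸ zs → a ≢ b →
              f a + f b ≤ sum (map f zs)
f+f≤sum-map f (here refl) (here refl) a≢b = ⊥-elim (a≢b refl)
f+f≤sum-map f {a} (here refl) (there b∈zs) _ = ℕₚ.+-monoʳ-≤ (f a) (f≤sum-map f b∈zs)
f+f≤sum-map f {a} {b} (there a∈zs) (here refl) _ =
  ℕₚ.≤-trans (ℕₚ.≤-reflexive (ℕₚ.+-comm (f a) (f b))) (ℕₚ.+-monoʳ-≤ (f b) (f≤sum-map f a∈zs))
f+f≤sum-map f {zs = z ∷ _} (there a∈zs) (there b∈zs) a≢b =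
  ℕₚ.≤-trans (f+f≤sum-map f a∈zs b∈zs a≢b) (ℕₚ.m≤n+m _ (f z))

module _ {N : ℕ} (V : Subset N) (p : Fin ℓ → Subset N) where

  ∈idx⁺ : ∀ {I i} → i ∈ I → i ∈ᴸ idx V p I
  ∈idx⁺ {I} {i} i∈I = ∈-filter⁺ (_∈? I) (∈-allFin i) i∈I

  ∈idx⁻ : ∀ {I i} → i ∈ᴸ idx V p I → i ∈ I
  ∈idx⁻ {I} i∈ = proj₂ (∈-filter⁻ (_∈? I) {xs = allFin ℓ} i∈)

  ∈V₀⁺ : ∀ {I i x} → i ∈ I → x ∈ p i → x ∈ V₀ V p I
  ∈V₀⁺ i∈I x∈pi = x∈⋃⁺ (map⁺ (lose (∈idx⁺ i∈I) x∈pi))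

  ∈V₀⁻ : ∀ {I x} → x ∈ V₀ V p I → ∃ λ i → i ∈ I × x ∈ p i
  ∈V₀⁻ {I} x∈ = let i , i∈ , x∈pi = find (map⁻ (x∈⋃⁻ _ x∈)) in i , ∈idx⁻ i∈ , x∈pi

  ∈delEdges⁺ : ∀ {I h j} → h ∈ I → h ≢ j → p h ─ p j ∈ᴸ delEdges V p I j
  ∈delEdges⁺ {j = j} h∈I h≢j =
    ∈-map⁺ (λ h → p h ─ p j) (∈-filter⁺ (λ h → ¬? (h ≟ j)) (∈idx⁺ h∈I) h≢j)

  ∈delEdges⁻ : ∀ {I j f} → f ∈ᴸ delEdges V p I j → ∃ λ h → h ∈ I × h ≢ j × f ≡ p h ─ p j
  ∈delEdges⁻ {I} {j} f∈ with ∈-map⁻ (λ h → p h ─ p j) f∈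
  ... | h , h∈ , refl =
    let h∈idx , h≢j = ∈-filter⁻ (λ h → ¬? (h ≟ j)) {xs = idx V p I} h∈
    in h , ∈idx⁻ h∈idx , h≢j , refl

  delEdges-mono : ∀ {I J j f} → I ⊆ J → f ∈ᴸ delEdges V p I j → f ∈ᴸ delEdges V p J j
  delEdges-mono I⊆J f∈ with ∈delEdges⁻ f∈
  ... | h , h∈I , h≢j , refl = ∈delEdges⁺ (I⊆J h∈I) h≢j

  Σ-idx-─ : ∀ {f : Fin ℓ → ℤ} {i} (I : Subset ℓ) → f i ≡ + 0 →
            Σ f (idx V p I) ≡ Σ f (idx V p (I - i))
  Σ-idx-─ I fi≡0 = Σ-filter-─ I fi≡0 (allFin ℓ)

module LastEdge {N : ℕ} (V : Subset N) (p : Fin ℓ → Subset N)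
  (p⊆V : ∀ i → p i ⊆ V) (p-antichain : ∀ i j → p i ⊆ p j → i ≡ j)
  (last : Fin ℓ) (∣e∣≤2 : ∣ p last ∣ ≤ 2) where

  G′ : Subset ℓ
  G′ = ⊤ - last

  e A : Subset N
  e = p last
  A = V₀ V p G′

  τ∖ : Subset ℓ → Fin ℓ → ℕ
  τ∖ I j = τ (delVertices V p j) (delEdges V p I j)

  gain : Fin ℓ → ℕ
  gain j = τ∖ ⊤ j ∸ τ∖ G′ j

  ∈G′⇒≢last : ∀ {i} → i ∈ G′ → i ≢ last
  ∈G′⇒≢last i∈G′ = x∉⁅y⁆⇒x≢y (x∈p─q⇒x∉q i∈G′)

  V∖p-transversal : ∀ j → Transversal (V ─ p j) (delEdges V p ⊤ j) (V ─ p j)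
  V∖p-transversal j = (λ v∈ → v∈) , All.tabulate meets
    where
    meets : ∀ {f} → f ∈ᴸ delEdges V p ⊤ j → Nonempty ((V ─ p j) ∩ f)
    meets f∈ with ∈delEdges⁻ V p f∈
    ... | h , _ , h≢j , refl =
      let v , v∈ph─pj = p⊈q⇒Nonempty[p─q] (p h) (p j) (λ ph⊆pj → h≢j (p-antichain h j ph⊆pj))
          v∈ph , v∉pj = x∈p─q⁻ v∈ph─pj
      in v , x∈p∩q⁺ (x∈p∧x∉q⇒x∈p─q (p⊆V h v∈ph) v∉pj , v∈ph─pj)

  τ∖G′≤τ∖⊤ : ∀ j → τ∖ G′ j ≤ τ∖ ⊤ j
  τ∖G′≤τ∖⊤ j = τ-mono (delEdges-mono V p {G′} {⊤} {j} (λ _ → ∈⊤))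

  -- Every vertex that e ∖ p j shares with an edge of G′ ∖ p j lies in e ∩ A ∖ p j,
  -- so the hypothesis makes e ∖ p j a new edge disjoint from all of G′ ∖ p j.
  0<gain : ∀ {j} → j ≢ last → e ∩ A ⊆ p j → 0 < gain j
  0<gain {j} j≢last e∩A⊆pj = ℕₚ.m<n⇒0<n∸m
    (τ-mono-strict (delEdges-mono V p {G′} {⊤} {j} (λ _ → ∈⊤))
      (∈delEdges⁺ V p ∈⊤ (λ last≡j → j≢last (sym last≡j))) disjoint (V∖p-transversal j))
    where
    disjoint : ∀ {f} → f ∈ᴸ delEdges V p G′ j → ∀ {v} → v ∈ f → v ∉ e ─ p j
    disjoint f∈ v∈f v∈e─pj with ∈delEdges⁻ V p f∈
    ... | h , h∈G′ , _ , refl =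
      let v∈ph , v∉pj = x∈p─q⁻ v∈f
      in v∉pj (e∩A⊆pj (x∈p∩q⁺ (p─q⊆p e (p j) v∈e─pj , ∈V₀⁺ V p h∈G′ v∈ph)))

  w-gain : ∀ m j → wt V p m ⊤ j ℤ.+ + gain j ≡ wt V p m G′ j
  w-gain m j = m-n+[n∸o]≡m-o m (τ∖G′≤τ∖⊤ j)

  V₀⊆A∪[e─A] : V₀ V p ⊤ ⊆ A ∪ (e ─ A)
  V₀⊆A∪[e─A] {v} v∈ with ∈V₀⁻ V p v∈ | v ∈? A
  ... | _            | yes v∈A = x∈p∪q⁺ (inj₁ v∈A)
  ... | i , _ , v∈pi | no v∉A with i ≟ last
  ...   | yes refl   = x∈p∪q⁺ (inj₂ (x∈p∧x∉q⇒x∈p─q v∈pi v∉A))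
  ...   | no i≢last  = ⊥-elim (v∉A (∈V₀⁺ V p (x∈p∧x≢y⇒x∈p-y ∈⊤ i≢last) v∈pi))

  ∣V₀∣≤∣A∣+∣e─A∣ : ∣ V₀ V p ⊤ ∣ ≤ ∣ A ∣ + ∣ e ─ A ∣
  ∣V₀∣≤∣A∣+∣e─A∣ = ℕₚ.≤-trans (p⊆q⇒∣p∣≤∣q∣ V₀⊆A∪[e─A]) (∣p∪q∣≤∣p∣+∣q∣ A (e ─ A))

  ∣e─A∣≤gain : ∀ {y h} → y ∈ e → y ∈ A → y ∈ p h → h ≢ last → ∣ e ─ A ∣ ≤ gain h
  ∣e─A∣≤gain {y} {h} y∈e y∈A y∈ph h≢last with nonempty? (e ─ A)
  ... | no e─A=∅        = ℕₚ.≤-trans (ℕₚ.≤-reflexive (Empty⇒∣p∣≡0 e─A=∅)) z≤n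
  ... | yes (x , x∈e─A) = ℕₚ.≤-trans ∣e─A∣≤1 (0<gain h≢last e∩A⊆ph)
    where
    ∣e─A∣≤1 : ∣ e ─ A ∣ ≤ 1
    ∣e─A∣≤1 = ℕ.s≤s⁻¹ (ℕₚ.<-≤-trans (p∩q≢∅⇒∣p─q∣<∣p∣ e A (y , x∈p∩q⁺ (y∈e , y∈A))) ∣e∣≤2)
    e∩A⊆ph : e ∩ A ⊆ p h
    e∩A⊆ph {v} v∈e∩A =
      let v∈e , v∈A = x∈p∩q⁻ e A v∈e∩A
          x∈e , x∉A = x∈p─q⁻ x∈e─A
      in subst (_∈ p h) (∣p∣≤2⇒≡ ∣e∣≤2 x∈e y∈e v∈e (λ { refl → x∉A y∈A }) (λ { refl → x∉A v∈A })) y∈ph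

  ys : List (Fin ℓ)
  ys = idx V p G′

  Γ : ℕ
  Γ = sum (map gain ys)

  ∣e─A∣≤Γ : ∀ {a b} → a ≢ last → b ≢ last → a ≢ b → ∣ e ─ A ∣ ≤ Γ
  ∣e─A∣≤Γ {a} {b} a≢last b≢last a≢b with nonempty? (e ∩ A)
  ... | yes (y , y∈e∩A) with x∈p∩q⁻ e A y∈e∩A
  ...   | y∈e , y∈A with ∈V₀⁻ V p y∈A
  ...     | h , h∈G′ , y∈ph = ℕₚ.≤-trans (∣e─A∣≤gain y∈e y∈A y∈ph (∈G′⇒≢last h∈G′))
                                          (f≤sum-map gain (∈idx⁺ V p h∈G′))
  ∣e─A∣≤Γ {a} {b} a≢last b≢last a≢b | no e∩A=∅ = begin
    ∣ e ─ A ∣       ≤⟨ ∣p─q∣≤∣p∣ e A ⟩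
    ∣ e ∣           ≤⟨ ∣e∣≤2 ⟩
    2               ≤⟨ ℕₚ.+-mono-≤ (0<gain a≢last vacuous) (0<gain b≢last vacuous) ⟩
    gain a + gain b ≤⟨ f+f≤sum-map gain (∈ys a≢last) (∈ys b≢last) a≢b ⟩
    Γ               ∎
    where
    open ℕₚ.≤-Reasoning
    vacuous : ∀ {j} → e ∩ A ⊆ p j
    vacuous v∈e∩A = ⊥-elim (e∩A=∅ (_ , v∈e∩A))
    ∈ys : ∀ {j} → j ≢ last → j ∈ᴸ ys
    ∈ys j≢last = ∈idx⁺ V p (x∈p∧x≢y⇒x∈p-y ∈⊤ j≢last)

  V₀+W-mono : ∀ m {a b} → a ≢ last → b ≢ last → a ≢ b → wt V p m ⊤ last ≡ + 0 →
              + ∣ V₀ V p ⊤ ∣ ℤ.+ W V p m ⊤ ℤ.≤ + ∣ A ∣ ℤ.+ W V p m G′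
  V₀+W-mono m a≢last b≢last a≢b w[last]≡0 = begin
    + ∣ V₀ V p ⊤ ∣ ℤ.+ W V p m ⊤            ≤⟨ ℤₚ.+-monoˡ-≤ (W V p m ⊤) (+≤+ ∣V₀∣≤∣A∣+Γ) ⟩
    + (∣ A ∣ + Γ) ℤ.+ W V p m ⊤             ≡⟨ cong (ℤ._+ W V p m ⊤) (ℤₚ.pos-+ ∣ A ∣ Γ) ⟩
    (+ ∣ A ∣ ℤ.+ + Γ) ℤ.+ W V p m ⊤         ≡⟨ xy∙z≈x∙zy (+ ∣ A ∣) (+ Γ) (W V p m ⊤) ⟩
    + ∣ A ∣ ℤ.+ (W V p m ⊤ ℤ.+ + Γ)         ≡⟨ cong (λ w → + ∣ A ∣ ℤ.+ (w ℤ.+ + Γ)) (Σ-idx-─ V p ⊤ w[last]≡0) ⟩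
    + ∣ A ∣ ℤ.+ (Σ (wt V p m ⊤) ys ℤ.+ + Γ) ≡⟨ cong (ℤ._+_ (+ ∣ A ∣)) (Σ-+-sum (w-gain m) ys) ⟩
    + ∣ A ∣ ℤ.+ W V p m G′                  ∎
    where
    open ℤₚ.≤-Reasoning
    ∣V₀∣≤∣A∣+Γ = ℕₚ.≤-trans ∣V₀∣≤∣A∣+∣e─A∣ (ℕₚ.+-monoʳ-≤ ∣ A ∣ (∣e─A∣≤Γ a≢last b≢last a≢b))

lemma2 : (N k m L : ℕ) (H : Hypergraph3 N) →
    CliqueNumber H k → 3 ≤ k →
    (m ≡ 2 ⊎ m ≡ 3 ⊎ m ≡ 4) →
    2 ≤ L →
    (Nc : Fin (suc L) → Subset N) →
    (∀ i → IsClique H (Nc i) × ∣ Nc i ∣ ≡ k) →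
    (∀ v → ∃ λ i → v ∉ Nc i) →
    (∀ i → ∃ λ v → ∀ j → j ≢ i → v ∈ Nc j) →
    ∣ ⋃ (map Nc (allFin (suc L))) ∣ ≡ k + m →
    (p : Fin (suc L) → Subset N) →
    (∀ i → ∣ p i ∣ ≡ 2 × p i ⊆ ⋃ (map Nc (allFin (suc L)))) →
    (∀ i j → (p i ⊆ Nc j → i ≡ j) × (i ≡ j → p i ⊆ Nc j)) →
    wt (⋃ (map Nc (allFin (suc L)))) p m ⊤ (fromℕ L) ≡ + 0 →
    (+ ∣ V₀ (⋃ (map Nc (allFin (suc L)))) p ⊤ ∣)
    ℤ.+ W (⋃ (map Nc (allFin (suc L)))) p m ⊤
    ℤ.≤ (+ ∣ V₀ (⋃ (map Nc (allFin (suc L)))) p (⊤ - fromℕ L) ∣)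
    ℤ.+ W (⋃ (map Nc (allFin (suc L)))) p m (⊤ - fromℕ L)
lemma2 N k m L H _ _ _ (s≤s (s≤s _)) Nc _ _ _ _ p p-pair p⊆N w[last]≡0 =
  LastEdge.V₀+W-mono V p (λ i → proj₂ (p-pair i)) p-antichain (fromℕ L)
    (ℕₚ.≤-reflexive (proj₁ (p-pair (fromℕ L)))) m {zero} {suc zero} (λ ()) (λ ()) (λ ()) w[last]≡0
  where
  V = ⋃ (map Nc (allFin (suc L)))
  p-antichain : ∀ i j → p i ⊆ p j → i ≡ j
  p-antichain i j pi⊆pj = proj₁ (p⊆N i j) (λ x∈pi → proj₂ (p⊆N j j) refl (pi⊆pj x∈pi))
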